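{- For all positive integers $m_1,m_2$, $$d_F(m_1,m_2)=d^h_F(m_1,m_2)+d^h_F(m_2,m_1)+d_F(m_1-1,m_2-1)$$ and $$d^h_F(m_1,m_2)=d_F(m_1-1,m_2)-d_F(m_1-1,m_2-1)+d^h_F(m_1-1,m_2-1).$$
   Context: For natural numbers $m_1,m_2$, $[m]=\{1,\dots,m\}$ with $[0]=\emptyset$; $d_F(m_1,m_2)$ is the number of maximal antichains in $[m_1]\times[m_2]$ for the dominance order $(x,y)>^*(z,w)$ iff $x\ge z$, $y\ge w$ with at least one strict inequality (an antichain is a set of pairwise $>^*$-incomparable elements; maximal means not properly contained in another antichain; in particular $d_F(0,n)=d_F(n,0)=1$). $d^h_F(m_1,m_2)$ is the number of words over the alphabet $\{h,v,d\}$ that begin with the letter $h$, contain neither $hv$ nor $vh$ as two consecutive letters, and satisfy $(\#h)+(\#d)=m_1$ and $(\#v)+(\#d)=m_2$, where $\#a$ is the number of occurrences of letter $a$ (equivalently, grid walks made of $h$, $v$ and diagonal $d$ moves with $h$ never followed by $v$ and $v$ never followed by $h$, starting with an $h$ move). -}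

module Defs where

open import Data.Nat using (ℕ; zero; suc; _+_; _≤_; _<_; _≤?_; _<?_)
open import Data.Nat.Properties using (_≟_)
open import Data.Bool using (Bool; true; false)
open import Data.Bool.Properties using () renaming (_≟_ to _≟ᵇ_)
open import Data.Fin using (Fin; toℕ)
open import Data.Fin.Properties using (all?)
open import Data.Vec using (Vec; []; _∷_; lookup; toList)
open import Data.List using (List; []; _∷_; length; filter; concatMap; map; _++_; upTo)
open import Data.Product using (_×_; _,_; proj₁; proj₂)
open import Data.Sum using (_⊎_)
open import Data.Empty using (⊥)
open import Data.Unit using (⊤; tt)
open import Relation.Nullary using (Dec; yes; no; ¬_)
open import Relation.Nullary.Decidable using (_×-dec_; _⊎-dec_; _→-dec_; ¬?; map′)
open import Relation.Binary.PropositionalEquality using (_≡_; refl)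

allVecs : {A : Set} → List A → (n : ℕ) → List (Vec A n)
allVecs xs zero = [] ∷ []
allVecs xs (suc n) = concatMap (λ x → map (x ∷_) (allVecs xs n)) xs

count : {A : Set} {P : A → Set} → ((a : A) → Dec (P a)) → List A → ℕ
count P? xs = length (filter P? xs)

allBool? : {P : Bool → Set} → ((b : Bool) → Dec (P b)) → Dec ((b : Bool) → P b)
allBool? {P} P? = map′ (λ { (t , f) true → t ; (t , f) false → f }) (λ h → h true , h false)
                       (P? true ×-dec P? false)

Searchable : Set → Set₁
Searchable A = {P : A → Set} → ((a : A) → Dec (P a)) → Dec ((a : A) → P a)

allVec? : {A : Set} → Searchable A → (n : ℕ) → Searchable (Vec A n)
allVec? sA zero {P} P? = map′ (λ { p [] → p }) (λ h → h []) (P? [])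
allVec? sA (suc n) {P} P? =
  map′ (λ { h (x ∷ xs) → h x xs }) (λ h x xs → h (x ∷ xs))
       (sA (λ x → allVec? sA n (λ xs → P? (x ∷ xs))))

-- The grid [m₁] × [m₂] and the dominance order >*
-- The element (i , j) : Fin m₁ × Fin m₂ stands for (toℕ i + 1 , toℕ j + 1).

Point : ℕ → ℕ → Set
Point m₁ m₂ = Fin m₁ × Fin m₂

_>*_ : {m₁ m₂ : ℕ} → Point m₁ m₂ → Point m₁ m₂ → Set
(x , y) >* (z , w) = (toℕ z ≤ toℕ x) × (toℕ w ≤ toℕ y) × ((toℕ z < toℕ x) ⊎ (toℕ w < toℕ y))

GridSubset : ℕ → ℕ → Set
GridSubset m₁ m₂ = Vec (Vec Bool m₂) m₁

_∈G_ : {m₁ m₂ : ℕ} → Point m₁ m₂ → GridSubset m₁ m₂ → Set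
(i , j) ∈G S = lookup (lookup S i) j ≡ true

_⊆G_ : {m₁ m₂ : ℕ} → GridSubset m₁ m₂ → GridSubset m₁ m₂ → Set
S ⊆G T = ∀ i j → (i , j) ∈G S → (i , j) ∈G T

IsAntichain : {m₁ m₂ : ℕ} → GridSubset m₁ m₂ → Set
IsAntichain S = ∀ a b → a ∈G S → b ∈G S → ¬ (a >* b)

IsMaximalAntichain : {m₁ m₂ : ℕ} → GridSubset m₁ m₂ → Set
IsMaximalAntichain {m₁} {m₂} S =
  IsAntichain S × ((T : GridSubset m₁ m₂) → IsAntichain T → S ⊆G T → T ⊆G S)

allPoint? : {m₁ m₂ : ℕ} → Searchable (Point m₁ m₂)
allPoint? {P = P} P? =
  map′ (λ { h (i , j) → h i j }) (λ h i j → h (i , j)) (all? (λ i → all? (λ j → P? (i , j))))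

>*? : {m₁ m₂ : ℕ} (a b : Point m₁ m₂) → Dec (a >* b)
>*? (x , y) (z , w) =
  (toℕ z ≤? toℕ x) ×-dec ((toℕ w ≤? toℕ y) ×-dec ((toℕ z <? toℕ x) ⊎-dec (toℕ w <? toℕ y)))

∈G? : {m₁ m₂ : ℕ} (a : Point m₁ m₂) (S : GridSubset m₁ m₂) → Dec (a ∈G S)
∈G? (i , j) S = lookup (lookup S i) j ≟ᵇ true

⊆G? : {m₁ m₂ : ℕ} (S T : GridSubset m₁ m₂) → Dec (S ⊆G T)
⊆G? S T = all? (λ i → all? (λ j → ∈G? (i , j) S →-dec ∈G? (i , j) T))

IsAntichain? : {m₁ m₂ : ℕ} (S : GridSubset m₁ m₂) → Dec (IsAntichain S)
IsAntichain? S = allPoint? (λ a → allPoint? (λ b →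
  ∈G? a S →-dec (∈G? b S →-dec ¬? (>*? a b))))

allGridSubset? : {m₁ m₂ : ℕ} → Searchable (GridSubset m₁ m₂)
allGridSubset? {m₁} {m₂} = allVec? (allVec? allBool? m₂) m₁

IsMaximalAntichain? : {m₁ m₂ : ℕ} (S : GridSubset m₁ m₂) → Dec (IsMaximalAntichain S)
IsMaximalAntichain? S = IsAntichain? S ×-dec
  allGridSubset? (λ T → IsAntichain? T →-dec (⊆G? S T →-dec ⊆G? T S))

allGridSubsets : (m₁ m₂ : ℕ) → List (GridSubset m₁ m₂)
allGridSubsets m₁ m₂ = allVecs (allVecs (true ∷ false ∷ []) m₂) m₁

dF : ℕ → ℕ → ℕ
dF m₁ m₂ = count IsMaximalAntichain? (allGridSubsets m₁ m₂)

data Letter : Set where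
  h v d : Letter

_≟L_ : (a b : Letter) → Dec (a ≡ b)
h ≟L h = yes refl
h ≟L v = no (λ ())
h ≟L d = no (λ ())
v ≟L h = no (λ ())
v ≟L v = yes refl
v ≟L d = no (λ ())
d ≟L h = no (λ ())
d ≟L v = no (λ ())
d ≟L d = yes refl

occ : Letter → List Letter → ℕ
occ a [] = 0
occ a (b ∷ w) with a ≟L b
... | yes _ = suc (occ a w)
... | no  _ = occ a w

StartsWithH : List Letter → Set
StartsWithH [] = ⊥
StartsWithH (a ∷ _) = a ≡ h

NoHVorVH : List Letter → Set
NoHVorVH [] = ⊤
NoHVorVH (a ∷ []) = ⊤
NoHVorVH (a ∷ b ∷ w) = ¬ (a ≡ h × b ≡ v) × ¬ (a ≡ v × b ≡ h) × NoHVorVH (b ∷ w)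

GoodWord : ℕ → ℕ → List Letter → Set
GoodWord m₁ m₂ w =
  StartsWithH w × NoHVorVH w × (occ h w + occ d w ≡ m₁) × (occ v w + occ d w ≡ m₂)

StartsWithH? : (w : List Letter) → Dec (StartsWithH w)
StartsWithH? [] = no (λ ())
StartsWithH? (a ∷ _) = a ≟L h

NoHVorVH? : (w : List Letter) → Dec (NoHVorVH w)
NoHVorVH? [] = yes tt
NoHVorVH? (a ∷ []) = yes tt
NoHVorVH? (a ∷ b ∷ w) =
  ¬? ((a ≟L h) ×-dec (b ≟L v)) ×-dec (¬? ((a ≟L v) ×-dec (b ≟L h)) ×-dec NoHVorVH? (b ∷ w))

GoodWord? : (m₁ m₂ : ℕ) (w : List Letter) → Dec (GoodWord m₁ m₂ w)
GoodWord? m₁ m₂ w = StartsWithH? w ×-dec (NoHVorVH? w ×-dec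
  ((occ h w + occ d w ≟ m₁) ×-dec (occ v w + occ d w ≟ m₂)))

wordsOfLength : ℕ → List (List Letter)
wordsOfLength k = map toList (allVecs (h ∷ v ∷ d ∷ []) k)

-- all words of length ≤ n (each exactly once); a word counted by dʰ_F(m₁,m₂)
-- has length (#h)+(#v)+(#d) ≤ m₁ + m₂
wordsUpTo : ℕ → List (List Letter)
wordsUpTo zero = wordsOfLength zero
wordsUpTo (suc n) = wordsUpTo n ++ wordsOfLength (suc n)

dhF : ℕ → ℕ → ℕ
dhF m₁ m₂ = count (GoodWord? m₁ m₂) (wordsUpTo (m₁ + m₂))

-- Read row by row, a maximal antichain of [m₁] × [m₂] has at most one point per row, its points move
-- strictly to smaller columns from row to row, and maximality says exactly that after an empty row
-- some later row has its point in the column just left of the last point seen (or in the last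
-- column, if no point has been seen yet).
-- Counting the subsets accepted by this row recursion yields a recurrence that is also satisfied by
-- the numbers of hv/vh-free words, so d_F(m₁, m₂) counts all such words with the given letter counts
-- and d^h_F those starting with h. Both identities then follow by sorting the words by their first
-- letter, together with the symmetry exchanging h and v.

module Submission where

open import Defs
open import Data.Nat using (ℕ; suc)
open import Data.Integer using (ℤ; +_; _-_) renaming (_+_ to _+ℤ_)
open import Data.Product using (_×_)
open import Relation.Binary.PropositionalEquality using (_≡_)
open Data.Nat using (_+_)

import Algebra.Properties.CommutativeSemigroup as CommutativeSemigroupProperties
open import Data.Bool using (Bool; true; false; not; _∧_; _∨_; if_then_else_; T)
open import Data.Bool.Properties using (T-∧; if-eta; ∨-zeroʳ) renaming (_≟_ to _≟ᵇ_)
open import Data.Empty using (⊥-elim)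
open import Data.Integer.Properties using (pos-+)
open import Data.Integer.Tactic.RingSolver using (solve-∀)
open import Data.List using (List; []; _∷_; map; concatMap; _++_)
open import Data.List.Properties using (map-++; map-∘; map-cong)
open import Data.Maybe using (Maybe; just; nothing; maybe′)
open import Data.Nat using (zero; _≤_; _<_; z≤n; s≤s; _<ᵇ_; _≡ᵇ_)
open import Data.Nat.ListAction using (sum)
open import Data.Nat.ListAction.Properties using (sum-++)
open import Data.Nat.Properties
  using (+-identityʳ; +-assoc; +-comm; +-suc; +-commutativeSemigroup; suc-injective; n≤1+n;
         ≤-refl; ≤-reflexive; ≤-trans; ≤-antisym; ≤-pred; <⇒≤; <-irrefl; <-trans; <-≤-trans; <⇒≱;
         ≮⇒≥; <-cmp; _<?_; <ᵇ⇒<; <⇒<ᵇ; ≡ᵇ⇒≡; ≡⇒≡ᵇ)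
open import Data.Product using (Σ; _,_; proj₁; proj₂; uncurry)
open import Data.Sum using (_⊎_; inj₁; inj₂)
open import Data.Unit using (tt)
open import Data.Vec using (Vec; []; _∷_; toList; lookup; tabulate)
open import Data.Vec.Properties using (lookup∘tabulate)
open import Data.Product.Properties using (≡-dec)
open import Data.Fin as Fin using (Fin; toℕ; fromℕ<) renaming (zero to fzero; suc to fsuc)
open import Data.Fin.Properties using (toℕ<n; toℕ-injective; toℕ-fromℕ<; any?)
open import Function using (_∘_)
open import Function.Bundles using (_⇔_; mk⇔; Equivalence)
open import Relation.Binary.PropositionalEquality
  using (refl; sym; trans; cong; cong₂; subst; _≢_; module ≡-Reasoning)
open import Relation.Nullary using (yes; no; ¬_; ⌊_⌋)
open import Relation.Binary.Definitions using (DecidableEquality; tri<; tri≈; tri>)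
open import Relation.Unary using (Decidable)

open Equivalence using (to; from)

module +-CS = CommutativeSemigroupProperties +-commutativeSemigroup

if-true : {A : Set} {b : Bool} {x y : A} → T b → (if b then x else y) ≡ x
if-true {b = true} _ = refl

if-false : {A : Set} {b : Bool} {x y : A} → ¬ T b → (if b then x else y) ≡ y
if-false {b = true}  ¬b = ⊥-elim (¬b tt)
if-false {b = false} _  = refl

countᵇ : {A : Set} → (A → Bool) → List A → ℕ
countᵇ f xs = sum (map (λ x → if f x then 1 else 0) xs)

count≡countᵇ : {A : Set} {P : A → Set} (P? : Decidable P) (f : A → Bool) →
               (∀ x → P x ⇔ T (f x)) → ∀ xs → count P? xs ≡ countᵇ f xs
count≡countᵇ P? f P⇔f [] = refl
count≡countᵇ P? f P⇔f (x ∷ xs) with P? x | f x | to (P⇔f x) | from (P⇔f x)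
... | yes _   | true  | _  | _  = cong suc (count≡countᵇ P? f P⇔f xs)
... | no _    | false | _  | _  = count≡countᵇ P? f P⇔f xs
... | yes Px  | false | P⇒ | _  = ⊥-elim (P⇒ Px)
... | no ¬Px  | true  | _  | ⇒P = ⊥-elim (¬Px (⇒P tt))

sum-map-zero : {A : Set} {g : A → ℕ} → (∀ x → g x ≡ 0) → ∀ xs → sum (map g xs) ≡ 0
sum-map-zero g≡0 []       = refl
sum-map-zero g≡0 (x ∷ xs) = cong₂ _+_ (g≡0 x) (sum-map-zero g≡0 xs)

sum-map-+ : {A : Set} (f g : A → ℕ) (xs : List A) →
            sum (map f xs) + sum (map g xs) ≡ sum (map (λ x → f x + g x) xs)
sum-map-+ f g []       = refl
sum-map-+ f g (x ∷ xs) =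
  trans (+-CS.interchange (f x) _ (g x) _) (cong (_+_ (f x + g x)) (sum-map-+ f g xs))

sum-map-++ : {A : Set} (g : A → ℕ) (xs ys : List A) →
             sum (map g (xs ++ ys)) ≡ sum (map g xs) + sum (map g ys)
sum-map-++ g xs ys = trans (cong sum (map-++ g xs ys)) (sum-++ (map g xs) (map g ys))

sum-map-concatMap : {A B : Set} (g : B → ℕ) (f : A → List B) (xs : List A) →
                    sum (map g (concatMap f xs)) ≡ sum (map (λ x → sum (map g (f x))) xs)
sum-map-concatMap g f []       = refl
sum-map-concatMap g f (x ∷ xs) =
  trans (sum-map-++ g (f x) (concatMap f xs)) (cong (_+_ (sum (map g (f x)))) (sum-map-concatMap g f xs))

sum-map-allVecs-suc : {A : Set} {n : ℕ} (g : Vec A (suc n) → ℕ) (xs : List A) →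
  sum (map g (allVecs xs (suc n))) ≡ sum (map (λ x → sum (map (g ∘ (x ∷_)) (allVecs xs n))) xs)
sum-map-allVecs-suc {n = n} g xs =
  trans (sum-map-concatMap g _ xs) (cong sum (map-cong (λ x → cong sum (sym (map-∘ (allVecs xs n)))) xs))

countᵇ-++ : {A : Set} (f : A → Bool) (xs ys : List A) → countᵇ f (xs ++ ys) ≡ countᵇ f xs + countᵇ f ys
countᵇ-++ f = sum-map-++ (λ x → if f x then 1 else 0)

countᵇ-map : {A B : Set} (f : B → Bool) (g : A → B) (xs : List A) → countᵇ f (map g xs) ≡ countᵇ (f ∘ g) xs
countᵇ-map f g xs = cong sum (sym (map-∘ xs))

countᵇ-false : {A : Set} (xs : List A) → countᵇ (λ _ → false) xs ≡ 0
countᵇ-false = sum-map-zero (λ _ → refl)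

countᵇ-∧ : {A : Set} (c : Bool) (f : A → Bool) (xs : List A) →
           countᵇ (λ x → c ∧ f x) xs ≡ (if c then countᵇ f xs else 0)
countᵇ-∧ true  f xs = refl
countᵇ-∧ false f xs = countᵇ-false xs

countᵇ-maybe : {A B : Set} (f : B → A → Bool) (mb : Maybe B) (xs : List A) →
               countᵇ (λ x → maybe′ (λ b → f b x) false mb) xs ≡ maybe′ (λ b → countᵇ (f b) xs) 0 mb
countᵇ-maybe f (just b) xs = refl
countᵇ-maybe f nothing  xs = countᵇ-false xs

sumBelow : ℕ → (ℕ → ℕ) → ℕ
sumBelow zero    f = 0
sumBelow (suc n) f = f 0 + sumBelow n (f ∘ suc)

sumBelow-suc : ∀ n f → sumBelow (suc n) f ≡ sumBelow n f + f n
sumBelow-suc zero    f = +-comm (f 0) 0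
sumBelow-suc (suc n) f =
  trans (cong (_+_ (f 0)) (sumBelow-suc n (f ∘ suc))) (sym (+-assoc (f 0) _ _))

sumBelow-zero : ∀ n {f} → (∀ y → f y ≡ 0) → sumBelow n f ≡ 0
sumBelow-zero zero    f≡0 = refl
sumBelow-zero (suc n) f≡0 = cong₂ _+_ (f≡0 0) (sumBelow-zero n (f≡0 ∘ suc))

sumBelow-cong : ∀ n {f g} → (∀ {y} → y < n → f y ≡ g y) → sumBelow n f ≡ sumBelow n g
sumBelow-cong zero    f≡g = refl
sumBelow-cong (suc n) f≡g = cong₂ _+_ (f≡g (s≤s z≤n)) (sumBelow-cong n (f≡g ∘ s≤s))

sumBelow-truncate : ∀ {k n f} → k ≤ n → (∀ {y} → k ≤ y → f y ≡ 0) → sumBelow n f ≡ sumBelow k f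
sumBelow-truncate {zero}  {n}     z≤n       f≡0 = sumBelow-zero n (λ _ → f≡0 z≤n)
sumBelow-truncate {suc k} {suc n} (s≤s k≤n) f≡0 = cong (_+_ _) (sumBelow-truncate k≤n (f≡0 ∘ s≤s))

sumBelow-single : ∀ {j n f} → j < n → (∀ {y} → y ≢ j → f y ≡ 0) → sumBelow n f ≡ f j
sumBelow-single {zero}  {suc n} _         f≡0 =
  trans (cong (_+_ _) (sumBelow-zero n (λ _ → f≡0 (λ ())))) (+-identityʳ _)
sumBelow-single {suc j} {suc n} (s≤s j<n) f≡0 =
  cong₂ _+_ (f≡0 (λ ())) (sumBelow-single j<n (λ y≢j → f≡0 (y≢j ∘ suc-injective)))

-- Free words and the lattice paths they encode

letters : List Letter
letters = h ∷ v ∷ d ∷ []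

sumLetters : (Letter → ℕ) → ℕ
sumLetters g = sum (map g letters)

countᵇ-wordsOfLength-suc : (f : List Letter → Bool) (n : ℕ) →
  countᵇ f (wordsOfLength (suc n)) ≡ sumLetters (λ x → countᵇ (f ∘ (x ∷_)) (wordsOfLength n))
countᵇ-wordsOfLength-suc f n =
  trans (countᵇ-map f toList (allVecs letters (suc n)))
  (trans (sum-map-allVecs-suc {n = n} (λ xs → if f (toList xs) then 1 else 0) letters)
         (cong sum (map-cong (λ x → sym (countᵇ-map (f ∘ (x ∷_)) toList (allVecs letters n))) letters)))

countᵇ-wordsUpTo-suc : (f : List Letter → Bool) (n : ℕ) →
  countᵇ f (wordsUpTo (suc n)) ≡
  (if f [] then 1 else 0) + sumLetters (λ x → countᵇ (f ∘ (x ∷_)) (wordsUpTo n))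
countᵇ-wordsUpTo-suc f zero = cong (_+_ (if f [] then 1 else 0)) (countᵇ-wordsOfLength-suc f zero)
countᵇ-wordsUpTo-suc f (suc n) = begin
  countᵇ f (wordsUpTo (suc n) ++ wordsOfLength (suc (suc n)))
    ≡⟨ countᵇ-++ f (wordsUpTo (suc n)) (wordsOfLength (suc (suc n))) ⟩
  countᵇ f (wordsUpTo (suc n)) + countᵇ f (wordsOfLength (suc (suc n)))
    ≡⟨ cong₂ _+_ (countᵇ-wordsUpTo-suc f n) (countᵇ-wordsOfLength-suc f (suc n)) ⟩
  ε + sumLetters shorter + sumLetters longest
    ≡⟨ +-assoc ε _ _ ⟩
  ε + (sumLetters shorter + sumLetters longest)
    ≡⟨ cong (_+_ ε) (sum-map-+ shorter longest letters) ⟩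
  ε + sumLetters (λ x → shorter x + longest x)
    ≡⟨ cong (_+_ ε) (cong sum (map-cong (λ x → sym (countᵇ-++ (f ∘ (x ∷_)) (wordsUpTo n) longer)) letters)) ⟩
  ε + sumLetters (λ x → countᵇ (f ∘ (x ∷_)) (wordsUpTo (suc n)))
    ∎
  where
  open ≡-Reasoning
  ε = if f [] then 1 else 0
  longer = wordsOfLength (suc n)
  shorter longest : Letter → ℕ
  shorter x = countᵇ (f ∘ (x ∷_)) (wordsUpTo n)
  longest x = countᵇ (f ∘ (x ∷_)) longer

-- The first clause makes allowed a d reduce to true for a variable a.
allowed : Letter → Letter → Bool
allowed _ d = true
allowed h v = false
allowed v h = false
allowed _ _ = true

allowed⁺ : ∀ {a x} → ¬ (a ≡ h × x ≡ v) → ¬ (a ≡ v × x ≡ h) → T (allowed a x)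
allowed⁺ {h} {v} ¬hv _   = ¬hv (refl , refl)
allowed⁺ {v} {h} _   ¬vh = ¬vh (refl , refl)
allowed⁺ {_} {d} _   _   = tt
allowed⁺ {h} {h} _   _   = tt
allowed⁺ {v} {v} _   _   = tt
allowed⁺ {d} {h} _   _   = tt
allowed⁺ {d} {v} _   _   = tt

allowed⁻ : ∀ {a x} → T (allowed a x) → ¬ (a ≡ h × x ≡ v) × ¬ (a ≡ v × x ≡ h)
allowed⁻ ax = (λ { (refl , refl) → ax }) , (λ { (refl , refl) → ax })

move : Letter → ℕ → ℕ → Maybe (ℕ × ℕ)
move h (suc m) n       = just (m , n)
move v m       (suc n) = just (m , n)
move d (suc m) (suc n) = just (m , n)
move _ _       _       = nothing

move-decreases : ∀ x m n {m′ n′} → move x m n ≡ just (m′ , n′) → suc (m′ + n′) ≤ m + n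
move-decreases h (suc m) n       refl = ≤-refl
move-decreases v m       (suc n) refl = ≤-reflexive (sym (+-suc m n))
move-decreases d (suc m) (suc n) refl = s≤s (≤-trans (n≤1+n (m + n)) (≤-reflexive (sym (+-suc m n))))

atOrigin : ℕ → ℕ → Bool
atOrigin m n = (m ≡ᵇ 0) ∧ (n ≡ᵇ 0)

mutual
  freeAfter : Letter → ℕ → ℕ → List Letter → Bool
  freeAfter a m n []      = atOrigin m n
  freeAfter a m n (x ∷ w) = allowed a x ∧ freeStartingWith x m n w

  freeStartingWith : Letter → ℕ → ℕ → List Letter → Bool
  freeStartingWith x m n w = maybe′ (uncurry λ m′ n′ → freeAfter x m′ n′ w) false (move x m n)

Counts : ℕ → ℕ → List Letter → Set
Counts m n w = (occ h w + occ d w ≡ m) × (occ v w + occ d w ≡ n)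

mutual
  freeAfter-sound : ∀ a m n w → T (freeAfter a m n w) → NoHVorVH (a ∷ w) × Counts m n w
  freeAfter-sound a zero    zero    []      _ = tt , refl , refl
  freeAfter-sound a zero    (suc n) []      ()
  freeAfter-sound a (suc m) n       []      ()
  freeAfter-sound a m       n       (x ∷ w) t with to T-∧ t
  ... | ax , xw = let ¬hv , ¬vh = allowed⁻ ax in
                  let free , counts = freeStartingWith-sound x m n w xw in
                  (¬hv , ¬vh , free) , counts

  freeStartingWith-sound : ∀ x m n w → T (freeStartingWith x m n w) → NoHVorVH (x ∷ w) × Counts m n (x ∷ w)
  freeStartingWith-sound h (suc m) n       w t with freeAfter-sound h m n w t
  ... | free , #h , #v = free , cong suc #h , #v
  freeStartingWith-sound v m       (suc n) w t with freeAfter-sound v m n w t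
  ... | free , #h , #v = free , #h , cong suc #v
  freeStartingWith-sound d (suc m) (suc n) w t with freeAfter-sound d m n w t
  ... | free , #h , #v = free , trans (+-suc (occ h w) (occ d w)) (cong suc #h)
                              , trans (+-suc (occ v w) (occ d w)) (cong suc #v)
  freeStartingWith-sound h zero    n       w ()
  freeStartingWith-sound v m       zero    w ()
  freeStartingWith-sound d zero    n       w ()
  freeStartingWith-sound d (suc m) zero    w ()

mutual
  freeAfter-complete : ∀ a m n w → NoHVorVH (a ∷ w) → Counts m n w → T (freeAfter a m n w)
  freeAfter-complete a .0 .0 []      _                   (refl , refl) = tt
  freeAfter-complete a m  n  (x ∷ w) (¬hv , ¬vh , free) counts =
    from T-∧ (allowed⁺ ¬hv ¬vh , freeStartingWith-complete x m n w free counts)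

  freeStartingWith-complete : ∀ x m n w → NoHVorVH (x ∷ w) → Counts m n (x ∷ w) →
                              T (freeStartingWith x m n w)
  freeStartingWith-complete h .(suc _) n w free (refl , #v) = freeAfter-complete h _ n w free (refl , #v)
  freeStartingWith-complete v m .(suc _) w free (#h , refl) = freeAfter-complete v m _ w free (#h , refl)
  freeStartingWith-complete d m n w free (#h , #v)
    rewrite sym #h | sym #v | +-suc (occ h w) (occ d w) | +-suc (occ v w) (occ d w) =
    freeAfter-complete d _ _ w free (refl , refl)

ifAllowed : Letter → Letter → ℕ → ℕ
ifAllowed a x n = if allowed a x then n else 0

-- paths a m n is the number of words w with #h + #d = m and #v + #d = n such that a ∷ w has no
-- factor hv or vh (see count-freeAfter); a = d imposes no constraint on the first letter of w.
paths : Letter → ℕ → ℕ → ℕ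
paths a zero    zero    = 1
paths a (suc m) zero    = ifAllowed a h (paths h m zero)
paths a zero    (suc n) = ifAllowed a v (paths v zero n)
paths a (suc m) (suc n) = ifAllowed a h (paths h m (suc n)) + ifAllowed a v (paths v (suc m) n) + paths d m n

startingWith : Letter → ℕ → ℕ → ℕ
startingWith x m n = maybe′ (uncurry (paths x)) 0 (move x m n)

paths-byFirstLetter : ∀ a m n →
  paths a m n ≡ (if atOrigin m n then 1 else 0) + sumLetters (λ x → ifAllowed a x (startingWith x m n))
paths-byFirstLetter a zero zero =
  sym (cong suc (cong₂ _+_ (if-eta (allowed a h)) (cong (_+ 0) (if-eta (allowed a v)))))
paths-byFirstLetter a (suc m) zero =
  sym (trans (cong (_+_ (ifAllowed a h (paths h m zero))) (cong (_+ 0) (if-eta (allowed a v))))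
             (+-identityʳ _))
paths-byFirstLetter a zero (suc n) =
  sym (cong₂ _+_ (if-eta (allowed a h)) (+-identityʳ _))
paths-byFirstLetter a (suc m) (suc n) =
  trans (+-assoc (ifAllowed a h (paths h m (suc n))) (ifAllowed a v (paths v (suc m) n)) (paths d m n))
        (cong (_+_ (ifAllowed a h (paths h m (suc n))))
              (cong (_+_ (ifAllowed a v (paths v (suc m) n))) (sym (+-identityʳ (paths d m n)))))

mutual
  count-freeAfter : ∀ N a m n → m + n ≤ N → countᵇ (freeAfter a m n) (wordsUpTo N) ≡ paths a m n
  count-freeAfter zero    a zero zero _ = refl
  count-freeAfter (suc N) a m    n    m+n≤N = begin
    countᵇ (freeAfter a m n) (wordsUpTo (suc N))
      ≡⟨ countᵇ-wordsUpTo-suc (freeAfter a m n) N ⟩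
    ε + sumLetters (λ x → countᵇ (λ w → allowed a x ∧ freeStartingWith x m n w) (wordsUpTo N))
      ≡⟨ cong (_+_ ε) (cong sum (map-cong firstLetter letters)) ⟩
    ε + sumLetters (λ x → ifAllowed a x (startingWith x m n))
      ≡⟨ paths-byFirstLetter a m n ⟨
    paths a m n
      ∎
    where
    open ≡-Reasoning
    ε = if atOrigin m n then 1 else 0
    firstLetter : ∀ x → countᵇ (λ w → allowed a x ∧ freeStartingWith x m n w) (wordsUpTo N)
                      ≡ ifAllowed a x (startingWith x m n)
    firstLetter x = trans (countᵇ-∧ (allowed a x) (freeStartingWith x m n) (wordsUpTo N))
                          (cong (λ c → if allowed a x then c else 0) (count-freeStartingWith N x m n m+n≤N))

  count-freeStartingWith : ∀ N x m n → m + n ≤ suc N →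
                           countᵇ (freeStartingWith x m n) (wordsUpTo N) ≡ startingWith x m n
  count-freeStartingWith N x m n m+n≤N+1 =
    trans (countᵇ-maybe (λ p w → freeAfter x (proj₁ p) (proj₂ p) w) (move x m n) (wordsUpTo N))
          (afterMove (move x m n) refl)
    where
    afterMove : ∀ mp → move x m n ≡ mp →
      maybe′ (λ p → countᵇ (freeAfter x (proj₁ p) (proj₂ p)) (wordsUpTo N)) 0 mp
        ≡ maybe′ (uncurry (paths x)) 0 mp
    afterMove nothing          _  = refl
    afterMove (just (m′ , n′)) eq =
      count-freeAfter N x m′ n′ (≤-pred (≤-trans (move-decreases x m n eq) m+n≤N+1))

goodᵇ : ℕ → ℕ → List Letter → Bool
goodᵇ m n (h ∷ w) = freeStartingWith h m n w
goodᵇ m n _       = false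

GoodWord⇔goodᵇ : ∀ m n w → GoodWord m n w ⇔ T (goodᵇ m n w)
GoodWord⇔goodᵇ m n []      = mk⇔ (λ ()) (λ ())
GoodWord⇔goodᵇ m n (h ∷ w) =
  mk⇔ (λ (_ , free , counts) → freeStartingWith-complete h m n w free counts)
      (λ t → refl , freeStartingWith-sound h m n w t)
GoodWord⇔goodᵇ m n (v ∷ w) = mk⇔ (λ ()) (λ ())
GoodWord⇔goodᵇ m n (d ∷ w) = mk⇔ (λ ()) (λ ())

count-goodᵇ : ∀ N m n → m + n ≤ N → countᵇ (goodᵇ m n) (wordsUpTo N) ≡ startingWith h m n
count-goodᵇ zero    zero n _      = refl
count-goodᵇ (suc N) m    n m+n≤N+1 =
  trans (countᵇ-wordsUpTo-suc (goodᵇ m n) N)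
  (trans (cong₂ _+_ (count-freeStartingWith N h m n m+n≤N+1)
                    (cong₂ _+_ (countᵇ-false (wordsUpTo N)) (cong (_+ 0) (countᵇ-false (wordsUpTo N)))))
         (+-identityʳ (startingWith h m n)))

dhF≡startingWith : ∀ m n → dhF m n ≡ startingWith h m n
dhF≡startingWith m n =
  trans (count≡countᵇ (GoodWord? m n) (goodᵇ m n) (GoodWord⇔goodᵇ m n) (wordsUpTo (m + n)))
        (count-goodᵇ (m + n) m n ≤-refl)

mirror : Letter → Letter
mirror h = v
mirror v = h
mirror d = d

allowed-mirror : ∀ a x → allowed (mirror a) (mirror x) ≡ allowed a x
allowed-mirror h h = refl
allowed-mirror h v = refl
allowed-mirror h d = refl
allowed-mirror v h = refl
allowed-mirror v v = refl
allowed-mirror v d = refl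
allowed-mirror d h = refl
allowed-mirror d v = refl
allowed-mirror d d = refl

ifAllowed-mirror : ∀ a x {n} → ifAllowed (mirror a) (mirror x) n ≡ ifAllowed a x n
ifAllowed-mirror a x {n} = cong (λ b → if b then n else 0) (allowed-mirror a x)

paths-mirror : ∀ a m n → paths (mirror a) n m ≡ paths a m n
paths-mirror a zero    zero    = refl
paths-mirror a (suc m) zero    =
  trans (cong (ifAllowed (mirror a) v) (paths-mirror h m zero)) (ifAllowed-mirror a h)
paths-mirror a zero    (suc n) =
  trans (cong (ifAllowed (mirror a) h) (paths-mirror v zero n)) (ifAllowed-mirror a v)
paths-mirror a (suc m) (suc n) = begin
  ifAllowed (mirror a) h (paths h n (suc m)) + ifAllowed (mirror a) v (paths v (suc n) m) + paths d n m
    ≡⟨ cong₂ _+_ (cong₂ _+_ (trans (cong (ifAllowed (mirror a) h) (paths-mirror v (suc m) n))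
                                   (ifAllowed-mirror a v))
                            (trans (cong (ifAllowed (mirror a) v) (paths-mirror h m (suc n)))
                                   (ifAllowed-mirror a h)))
                 (paths-mirror d m n) ⟩
  ifAllowed a v (paths v (suc m) n) + ifAllowed a h (paths h m (suc n)) + paths d m n
    ≡⟨ cong (_+ paths d m n) (+-comm (ifAllowed a v (paths v (suc m) n)) _) ⟩
  ifAllowed a h (paths h m (suc n)) + ifAllowed a v (paths v (suc m) n) + paths d m n
    ∎
  where open ≡-Reasoning

paths-d-split-h : ∀ m n → paths d m n ≡ startingWith h m n + paths v m n
paths-d-split-h zero    zero    = refl
paths-d-split-h zero    (suc n) = refl
paths-d-split-h (suc m) zero    = sym (+-identityʳ (paths h m zero))
paths-d-split-h (suc m) (suc n) = +-assoc (paths h m (suc n)) (paths v (suc m) n) (paths d m n)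

paths-d-split-v : ∀ m n → paths d m (suc n) ≡ paths h m (suc n) + startingWith v m (suc n)
paths-d-split-v zero    n = refl
paths-d-split-v (suc m) n =
  trans (+-CS.xy∙z≈xz∙y (paths h m (suc n)) (paths v (suc m) n) (paths d m n))
        (cong (_+ paths v (suc m) n) (cong (_+ paths d m n) (sym (+-identityʳ (paths h m (suc n))))))

paths-h-zeroʳ : ∀ m → paths h m zero ≡ 1
paths-h-zeroʳ zero    = refl
paths-h-zeroʳ (suc m) = paths-h-zeroʳ m

paths-d-zeroʳ : ∀ m → paths d m zero ≡ 1
paths-d-zeroʳ zero    = refl
paths-d-zeroʳ (suc m) = paths-h-zeroʳ m

paths-d-zeroˡ : ∀ n → paths d zero n ≡ 1
paths-d-zeroˡ n = trans (paths-mirror d n zero) (paths-d-zeroʳ n)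

paths-v-sumBelow : ∀ m n → paths v (suc m) n ≡ sumBelow n (paths d m)
paths-v-sumBelow m zero    = refl
paths-v-sumBelow m (suc n) =
  trans (cong (_+ paths d m n) (paths-v-sumBelow m n)) (sym (sumBelow-suc n (paths d m)))

data RowShape : Set where
  empty   : RowShape
  single  : ℕ → RowShape
  several : RowShape

consTrue : RowShape → RowShape
consTrue empty = single 0
consTrue _     = several

consFalse : RowShape → RowShape
consFalse empty      = empty
consFalse (single y) = single (suc y)
consFalse several    = several

shape : ∀ {m} → Vec Bool m → RowShape
shape []          = empty
shape (true ∷ r)  = consTrue (shape r)
shape (false ∷ r) = consFalse (shape r)

OnlyAt : ∀ {m} → Vec Bool m → Fin m → Set
OnlyAt r j = lookup r j ≡ true × (∀ {j′} → lookup r j′ ≡ true → j′ ≡ j)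

shape-empty : ∀ {m} (r : Vec Bool m) → shape r ≡ empty → ∀ j → lookup r j ≡ false
shape-empty (true ∷ r) eq j with shape r
shape-empty (true ∷ r) () j | empty
shape-empty (true ∷ r) () j | single _
shape-empty (true ∷ r) () j | several
shape-empty (false ∷ r) eq fzero    = refl
shape-empty (false ∷ r) eq (fsuc j) with shape r in e
shape-empty (false ∷ r) eq (fsuc j) | empty = shape-empty r e j
shape-empty (false ∷ r) () (fsuc j) | single _
shape-empty (false ∷ r) () (fsuc j) | several

shape-single : ∀ {m} (r : Vec Bool m) {y} → shape r ≡ single y → Σ (Fin m) λ j → toℕ j ≡ y × OnlyAt r j
shape-single (true ∷ r) eq with shape r in e
shape-single (true ∷ r) refl | empty = fzero , refl , refl , only
  where
  only : ∀ {j′} → lookup (true ∷ r) j′ ≡ true → j′ ≡ fzero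
  only {fzero}   _ = refl
  only {fsuc j′} t with () ← trans (sym t) (shape-empty r e j′)
shape-single (true ∷ r) () | single _
shape-single (true ∷ r) () | several
shape-single (false ∷ r) eq with shape r in e
shape-single (false ∷ r) () | empty
shape-single (false ∷ r) refl | single _ with shape-single r e
... | j , refl , rj , only = fsuc j , refl , rj , only′
  where
  only′ : ∀ {j′} → lookup (false ∷ r) j′ ≡ true → j′ ≡ fsuc j
  only′ {fzero}   ()
  only′ {fsuc j′} t = cong fsuc (only t)
shape-single (false ∷ r) () | several

shape-several : ∀ {m} (r : Vec Bool m) → shape r ≡ several →
  Σ (Fin m) λ j → Σ (Fin m) λ j′ → toℕ j < toℕ j′ × lookup r j ≡ true × lookup r j′ ≡ true
shape-several (true ∷ r) eq with shape r in e
shape-several (true ∷ r) () | empty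
shape-several (true ∷ r) refl | single _ with shape-single r e
... | j , _ , rj , _ = fzero , fsuc j , s≤s z≤n , refl , rj
shape-several (true ∷ r) refl | several with shape-several r e
... | _ , j′ , _ , _ , rj′ = fzero , fsuc j′ , s≤s z≤n , refl , rj′
shape-several (false ∷ r) eq with shape r in e
shape-several (false ∷ r) () | empty
shape-several (false ∷ r) () | single _
shape-several (false ∷ r) refl | several with shape-several r e
... | j , j′ , j<j′ , rj , rj′ = fsuc j , fsuc j′ , s≤s j<j′ , rj , rj′

z>*z⇒> : ∀ {m₁ m₂} {j j′ : Fin m₂} → _>*_ {suc m₁} (fzero , j) (fzero , j′) → toℕ j′ < toℕ j
z>*z⇒> (_ , _ , inj₂ j′<j) = j′<j

>⇒z>*z : ∀ {m₁ m₂} {j j′ : Fin m₂} → toℕ j′ < toℕ j → _>*_ {suc m₁} (fzero , j) (fzero , j′)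
>⇒z>*z j′<j = z≤n , <⇒≤ j′<j , inj₂ j′<j

z≯*s : ∀ {m₁ m₂} {i : Fin m₁} {j j′ : Fin m₂} → ¬ _>*_ {suc m₁} (fzero , j) (fsuc i , j′)
z≯*s (() , _)

s>*z⇒≤ : ∀ {m₁ m₂} {i : Fin m₁} {j j′ : Fin m₂} → _>*_ {suc m₁} (fsuc i , j′) (fzero , j) → toℕ j ≤ toℕ j′
s>*z⇒≤ (_ , j≤j′ , _) = j≤j′

≤⇒s>*z : ∀ {m₁ m₂} {i : Fin m₁} {j j′ : Fin m₂} → toℕ j ≤ toℕ j′ → _>*_ {suc m₁} (fsuc i , j′) (fzero , j)
≤⇒s>*z j≤j′ = z≤n , j≤j′ , inj₁ (s≤s z≤n)

module _ {m₁ m₂ : ℕ} {i i′ : Fin m₁} {j j′ : Fin m₂} where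

  s>*s⇒>* : _>*_ {suc m₁} (fsuc i , j) (fsuc i′ , j′) → (i , j) >* (i′ , j′)
  s>*s⇒>* (s≤s i′≤i , j′≤j , inj₁ (s≤s i′<i)) = i′≤i , j′≤j , inj₁ i′<i
  s>*s⇒>* (s≤s i′≤i , j′≤j , inj₂ j′<j)       = i′≤i , j′≤j , inj₂ j′<j

  >*⇒s>*s : (i , j) >* (i′ , j′) → _>*_ {suc m₁} (fsuc i , j) (fsuc i′ , j′)
  >*⇒s>*s (i′≤i , j′≤j , inj₁ i′<i) = s≤s i′≤i , j′≤j , inj₁ (s≤s i′<i)
  >*⇒s>*s (i′≤i , j′≤j , inj₂ j′<j) = s≤s i′≤i , j′≤j , inj₂ j′<j

>*-irrefl : ∀ {m₁ m₂} (p : Point m₁ m₂) → ¬ p >* p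
>*-irrefl p (_ , _ , inj₁ i<i) = <-irrefl refl i<i
>*-irrefl p (_ , _ , inj₂ j<j) = <-irrefl refl j<j

Incomparable : ∀ {m₁ m₂} → GridSubset m₁ m₂ → Point m₁ m₂ → Set
Incomparable S p = ∀ q → q ∈G S → ¬ p >* q × ¬ q >* p

module _ {m₁ m₂ : ℕ} {r : Vec Bool m₂} {S : GridSubset m₁ m₂} where

  antichain-tail : IsAntichain (r ∷ S) → IsAntichain S
  antichain-tail anti (i , j) (i′ , j′) p q = anti (fsuc i , j) (fsuc i′ , j′) p q ∘ >*⇒s>*s

  incomparable-tail : ∀ {i j} → Incomparable (r ∷ S) (fsuc i , j) → Incomparable S (i , j)
  incomparable-tail inc (i′ , j′) q =
    proj₁ (inc (fsuc i′ , j′) q) ∘ >*⇒s>*s , proj₂ (inc (fsuc i′ , j′) q) ∘ >*⇒s>*s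

  incomparable-cons : ∀ {i j} → Incomparable S (i , j) →
    (∀ {j′} → lookup r j′ ≡ true → ¬ _>*_ {suc m₁} (fsuc i , j) (fzero , j′)) →
    Incomparable (r ∷ S) (fsuc i , j)
  incomparable-cons inc notAbove (fzero   , j′) q = notAbove q , z≯*s
  incomparable-cons inc notAbove (fsuc i′ , j′) q =
    proj₁ (inc (i′ , j′) q) ∘ s>*s⇒>* , proj₂ (inc (i′ , j′) q) ∘ s>*s⇒>*

-- Maximal antichains as solutions of a row-by-row recursion

-- S consists of the rows of a maximal antichain that follow a row whose element lies in column k
-- (for k = m₂: all rows); mustReach says that an empty row came after that element, so that some
-- row of S must have its element in column k − 1.
record MaximalBelow {m₁ m₂ : ℕ} (k : ℕ) (mustReach : Bool) (S : GridSubset m₁ m₂) : Set where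
  field
    antichain : IsAntichain S
    below     : ∀ {i j} → (i , j) ∈G S → toℕ j < k
    saturated : ∀ {i j} → toℕ j < k → Incomparable S (i , j) → (i , j) ∈G S
    reaches   : T mustReach → Σ (Fin m₁) λ i → Σ (Fin m₂) λ j → suc (toℕ j) ≡ k × (i , j) ∈G S

open MaximalBelow

module _ {m₁ m₂ : ℕ} where

  _≟ₚ_ : DecidableEquality (Point m₁ m₂)
  _≟ₚ_ = ≡-dec Fin._≟_ Fin._≟_

  insert : Point m₁ m₂ → GridSubset m₁ m₂ → GridSubset m₁ m₂
  insert p S = tabulate λ i → tabulate λ j → ⌊ (i , j) ≟ₚ p ⌋ ∨ lookup (lookup S i) j

  lookup-insert : ∀ p S i j → lookup (lookup (insert p S) i) j ≡ (⌊ (i , j) ≟ₚ p ⌋ ∨ lookup (lookup S i) j)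
  lookup-insert p S i j = trans (cong (λ row → lookup row j) (lookup∘tabulate _ i)) (lookup∘tabulate _ j)

  ∈-insert : ∀ p S → p ∈G insert p S
  ∈-insert p@(i , j) S with p ≟ₚ p | lookup-insert p S i j
  ... | yes _   | eq = eq
  ... | no p≢p  | _  = ⊥-elim (p≢p refl)

  ⊆-insert : ∀ p S → S ⊆G insert p S
  ⊆-insert p S i j q∈S = trans (lookup-insert p S i j) (trans (cong (_ ∨_) q∈S) (∨-zeroʳ _))

  ∈-insert⁻ : ∀ p S q → q ∈G insert p S → q ≡ p ⊎ q ∈G S
  ∈-insert⁻ p S (i , j) q∈ with (i , j) ≟ₚ p | lookup-insert p S i j
  ... | yes q≡p | _  = inj₁ q≡p
  ... | no  _   | eq = inj₂ (trans (sym eq) q∈)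

  insert-antichain : ∀ {p S} → IsAntichain S → Incomparable S p → IsAntichain (insert p S)
  insert-antichain {p} {S} anti inc q q′ q∈ q′∈ with ∈-insert⁻ p S q q∈ | ∈-insert⁻ p S q′ q′∈
  ... | inj₁ refl | inj₁ refl = >*-irrefl p
  ... | inj₁ refl | inj₂ q′∈S = proj₁ (inc q′ q′∈S)
  ... | inj₂ q∈S  | inj₁ refl = proj₂ (inc q q∈S)
  ... | inj₂ q∈S  | inj₂ q′∈S = anti q q′ q∈S q′∈S

  maximal⇒MaximalBelow : ∀ {S : GridSubset m₁ m₂} → IsMaximalAntichain S → MaximalBelow m₂ false S
  maximal⇒MaximalBelow {S} (anti , maximal) = record
    { antichain = anti
    ; below     = λ {_} {j} _ → toℕ<n j
    ; saturated = λ {i} {j} _ inc →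
        maximal (insert (i , j) S) (insert-antichain {S = S} anti inc) (⊆-insert (i , j) S)
                i j (∈-insert (i , j) S)
    ; reaches   = λ ()
    }

  MaximalBelow⇒maximal : ∀ {S : GridSubset m₁ m₂} → MaximalBelow m₂ false S → IsMaximalAntichain S
  MaximalBelow⇒maximal M = antichain M , λ U antiU S⊆U i j p∈U →
    saturated M (toℕ<n j) λ q@(i′ , j′) q∈S →
      antiU (i , j) q p∈U (S⊆U i′ j′ q∈S) , antiU q (i , j) (S⊆U i′ j′ q∈S) p∈U

-- The transitions of the row recursion: after an empty row column k − 1 must still be reached
-- (if k > 0), and a row whose only element lies in column y is admissible if y < k, resp. y = k − 1.
afterEmpty : ℕ → Bool → Bool
afterEmpty zero    mustReach = mustReach
afterEmpty (suc _) _         = true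

afterEmpty-reach : ∀ k {b} → T b → T (afterEmpty k b)
afterEmpty-reach zero    t = t
afterEmpty-reach (suc k) _ = tt

singleOk : ℕ → Bool → ℕ → Bool
singleOk k false y = y <ᵇ k
singleOk k true  y = suc y ≡ᵇ k

singleOk⇒< : ∀ {k} b y → T (singleOk k b y) → y < k
singleOk⇒< {k} false y ok = <ᵇ⇒< y k ok
singleOk⇒< {k} true  y ok = ≤-reflexive (≡ᵇ⇒≡ (suc y) k ok)

module _ {m₁ m₂ : ℕ} {r : Vec Bool m₂} {S : GridSubset m₁ m₂} where

  ∉-emptyRow : (∀ j → lookup r j ≡ false) → ∀ {j} → lookup r j ≢ true
  ∉-emptyRow r≡∅ {j} t with () ← trans (sym t) (r≡∅ j)

  emptyRow-sound : ∀ {k b} → (∀ j → lookup r j ≡ false) →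
                   MaximalBelow k (afterEmpty k b) S → MaximalBelow k b (r ∷ S)
  emptyRow-sound {k} {b} r≡∅ M = record
    { antichain = anti
    ; below     = λ {i} → bel {i}
    ; saturated = λ {i} → sat {i}
    ; reaches   = λ t → let i , j , reached , p = reaches M (afterEmpty-reach k t) in fsuc i , j , reached , p
    }
    where
    ∉r = ∉-emptyRow r≡∅

    anti : IsAntichain (r ∷ S)
    anti (fzero  , _) _               p _ = ⊥-elim (∉r p)
    anti (fsuc _ , _) (fzero , _)     _ q = ⊥-elim (∉r q)
    anti (fsuc i , j) (fsuc i′ , j′) p q = antichain M (i , j) (i′ , j′) p q ∘ s>*s⇒>*

    bel : ∀ {i j} → (i , j) ∈G (r ∷ S) → toℕ j < k
    bel {fzero}  p = ⊥-elim (∉r p)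
    bel {fsuc i} p = below M p

    -- Column k − 1 is reached below the empty row, and that element dominates (0, j).
    dominated : ∀ {k j} → toℕ j < k → MaximalBelow k (afterEmpty k b) S → ¬ Incomparable (r ∷ S) (fzero , j)
    dominated {suc k} (s≤s j≤k) M′ inc with reaches M′ tt
    ... | i′ , j′ , refl , q = proj₂ (inc (fsuc i′ , j′) q) (≤⇒s>*z j≤k)

    sat : ∀ {i j} → toℕ j < k → Incomparable (r ∷ S) (i , j) → (i , j) ∈G (r ∷ S)
    sat {fzero}  j<k inc = ⊥-elim (dominated j<k M inc)
    sat {fsuc i} j<k inc = saturated M j<k (incomparable-tail inc)

  emptyRow-complete : ∀ {k b} → k ≤ m₂ → (∀ j → lookup r j ≡ false) →
                      MaximalBelow k b (r ∷ S) → MaximalBelow k (afterEmpty k b) S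
  emptyRow-complete {k} {b} k≤m₂ r≡∅ M = record
    { antichain = antichain-tail (antichain M)
    ; below     = λ {i} → below M {fsuc i}
    ; saturated = λ j<k inc → saturated M j<k (incomparable-cons inc λ q → ⊥-elim (∉r q))
    ; reaches   = reach k≤m₂ M
    }
    where
    ∉r = ∉-emptyRow r≡∅

    -- If no row of S met column k − 1, the point (0, k − 1) would be incomparable to all of r ∷ S.
    reach : ∀ {k} → k ≤ m₂ → MaximalBelow k b (r ∷ S) →
            T (afterEmpty k b) → Σ (Fin m₁) λ i → Σ (Fin m₂) λ j → suc (toℕ j) ≡ k × (i , j) ∈G S
    reach {zero} _ M′ t with reaches M′ t
    ... | _ , _ , () , _
    reach {suc k} k<m₂ M′ _ = columnMet (fromℕ< k<m₂) (toℕ-fromℕ< k<m₂)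
      where
      columnMet : ∀ c → toℕ c ≡ k → Σ (Fin m₁) λ i → Σ (Fin m₂) λ j → suc (toℕ j) ≡ suc k × (i , j) ∈G S
      columnMet c c≡k with any? (λ i → lookup (lookup S i) c ≟ᵇ true)
      ... | yes (i , q) = i , c , cong suc c≡k , q
      ... | no  ∄      = ⊥-elim (∉r (saturated M′ (s≤s (≤-reflexive c≡k)) incomparable))
        where
        incomparable : Incomparable (r ∷ S) (fzero , c)
        incomparable (fzero    , _)  q = ⊥-elim (∉r q)
        incomparable (fsuc i′ , j′) q = z≯*s , λ g → ∄ (i′ , subst (λ c′ → (i′ , c′) ∈G S) (j′≡c g) q)
          where
          j′≤k : toℕ j′ ≤ k
          j′≤k = ≤-pred (below M′ {fsuc i′} q)
          j′≡c : _>*_ {suc m₁} (fsuc i′ , j′) (fzero , c) → j′ ≡ c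
          j′≡c g = toℕ-injective (≤-antisym (subst (toℕ j′ ≤_) (sym c≡k) j′≤k) (s>*z⇒≤ g))

  singleRow-sound : ∀ {k b jy} → OnlyAt r jy → T (singleOk k b (toℕ jy)) →
                    MaximalBelow (toℕ jy) false S → MaximalBelow k b (r ∷ S)
  singleRow-sound {k} {b} {jy} (r[jy] , only) ok M = record
    { antichain = anti
    ; below     = λ {i} → bel {i}
    ; saturated = λ {i} → sat {i}
    ; reaches   = reach b ok
    }
    where
    y<k : toℕ jy < k
    y<k = singleOk⇒< b (toℕ jy) ok

    anti : IsAntichain (r ∷ S)
    anti (fzero , j) (fzero , j′) p q g =
      <-irrefl (cong toℕ (trans (only q) (sym (only p)))) (z>*z⇒> {m₁} g)
    anti (fzero , _) (fsuc _ , _) _ _ = z≯*s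
    anti (fsuc i , j) (fzero , j′) p q g =
      <⇒≱ (below M p) (subst (λ c → toℕ c ≤ toℕ j) (only q) (s>*z⇒≤ g))
    anti (fsuc i , j) (fsuc i′ , j′) p q = antichain M (i , j) (i′ , j′) p q ∘ s>*s⇒>*

    bel : ∀ {i j} → (i , j) ∈G (r ∷ S) → toℕ j < k
    bel {fzero}  p = subst (λ c → toℕ c < k) (sym (only p)) y<k
    bel {fsuc i} p = <-trans (below M p) y<k

    sat : ∀ {i j} → toℕ j < k → Incomparable (r ∷ S) (i , j) → (i , j) ∈G (r ∷ S)
    sat {fzero} {j} _ inc with <-cmp (toℕ j) (toℕ jy)
    ... | tri< j<y _ _ = ⊥-elim (proj₂ (inc (fzero , jy) r[jy]) (>⇒z>*z {m₁} j<y))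
    ... | tri≈ _ j≡y _ = subst (λ c → lookup r c ≡ true) (sym (toℕ-injective j≡y)) r[jy]
    ... | tri> _ _ y<j = ⊥-elim (proj₁ (inc (fzero , jy) r[jy]) (>⇒z>*z {m₁} y<j))
    sat {fsuc i} {j} _ inc with toℕ j <? toℕ jy
    ... | yes j<y = saturated M j<y (incomparable-tail inc)
    ... | no  j≮y = ⊥-elim (proj₁ (inc (fzero , jy) r[jy]) (≤⇒s>*z (≮⇒≥ j≮y)))

    reach : ∀ b → T (singleOk k b (toℕ jy)) →
            T b → Σ (Fin (suc m₁)) λ i → Σ (Fin m₂) λ j → suc (toℕ j) ≡ k × (i , j) ∈G (r ∷ S)
    reach true ok _ = fzero , jy , ≡ᵇ⇒≡ (suc (toℕ jy)) k ok , r[jy]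

  singleRow-complete : ∀ {k b jy} → OnlyAt r jy → MaximalBelow k b (r ∷ S) →
                       T (singleOk k b (toℕ jy)) × MaximalBelow (toℕ jy) false S
  singleRow-complete {k} {b} {jy} (r[jy] , only) M = ok b M , record
    { antichain = antichain-tail (antichain M)
    ; below     = λ {i} → bel {i}
    ; saturated = λ j<y inc → saturated M (<-trans j<y y<k) (incomparable-cons inc λ q g →
        <⇒≱ j<y (subst (λ c → toℕ c ≤ _) (only q) (s>*z⇒≤ g)))
    ; reaches   = λ ()
    }
    where
    y<k : toℕ jy < k
    y<k = below M {fzero} r[jy]

    bel : ∀ {i j} → (i , j) ∈G S → toℕ j < toℕ jy
    bel {i} {j} p with toℕ j <? toℕ jy
    ... | yes j<y = j<y
    ... | no  j≮y = ⊥-elim (antichain M (fsuc i , j) (fzero , jy) p r[jy] (≤⇒s>*z (≮⇒≥ j≮y)))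

    ok : ∀ b → MaximalBelow k b (r ∷ S) → T (singleOk k b (toℕ jy))
    ok false _  = <⇒<ᵇ y<k
    ok true  M′ with reaches M′ tt
    ... | fzero   , j , refl , p = ≡⇒≡ᵇ (suc (toℕ jy)) (suc (toℕ j)) (cong (suc ∘ toℕ) (sym (only p)))
    ... | fsuc i , j , refl , p = ⊥-elim (<-irrefl refl (<-≤-trans (bel p) (≤-pred y<k)))

  severalRow-¬antichain : ∀ {j j′} → lookup r j ≡ true → lookup r j′ ≡ true → toℕ j < toℕ j′ →
                          ¬ IsAntichain (r ∷ S)
  severalRow-¬antichain {j} {j′} r[j] r[j′] j<j′ anti =
    anti (fzero , j′) (fzero , j) r[j′] r[j] (>⇒z>*z {m₁} j<j′)

-- Counting maximal antichains

sum-shape : ∀ m (G : RowShape → ℕ) → G several ≡ 0 →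
            sum (map (G ∘ shape) (allVecs (true ∷ false ∷ []) m)) ≡ G empty + sumBelow m (G ∘ single)
sum-shape zero    G G[several]≡0 = refl
sum-shape (suc m) G G[several]≡0 = begin
  sum (map (G ∘ shape) (allVecs (true ∷ false ∷ []) (suc m)))
    ≡⟨ sum-map-allVecs-suc {n = m} (G ∘ shape) (true ∷ false ∷ []) ⟩
  sum (map (G ∘ consTrue ∘ shape) rows) + (sum (map (G ∘ consFalse ∘ shape) rows) + 0)
    ≡⟨ cong₂ _+_ (sum-shape m (G ∘ consTrue) G[several]≡0)
                 (trans (+-identityʳ _) (sum-shape m (G ∘ consFalse) G[several]≡0)) ⟩
  (G (single 0) + sumBelow m (λ _ → G several)) + (G empty + sumBelow m (G ∘ single ∘ suc))
    ≡⟨ cong (λ s → (G (single 0) + s) + rest) (sumBelow-zero m (λ _ → G[several]≡0)) ⟩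
  (G (single 0) + 0) + (G empty + sumBelow m (G ∘ single ∘ suc))
    ≡⟨ cong (_+ rest) (+-identityʳ (G (single 0))) ⟩
  G (single 0) + (G empty + sumBelow m (G ∘ single ∘ suc))
    ≡⟨ +-CS.x∙yz≈y∙xz (G (single 0)) (G empty) _ ⟩
  G empty + sumBelow (suc m) (G ∘ single)
    ∎
  where
  open ≡-Reasoning
  rows = allVecs (true ∷ false ∷ []) m
  rest = G empty + sumBelow m (G ∘ single ∘ suc)

module _ {m₂ : ℕ} where

  mutual
    accepts : ∀ {m₁} → ℕ → Bool → GridSubset m₁ m₂ → Bool
    accepts k b []      = not b
    accepts k b (r ∷ S) = acceptsRow k b (shape r) S

    acceptsRow : ∀ {m₁} → ℕ → Bool → RowShape → GridSubset m₁ m₂ → Bool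
    acceptsRow k b empty      S = accepts k (afterEmpty k b) S
    acceptsRow k b (single y) S = singleOk k b y ∧ accepts y false S
    acceptsRow k b several    S = false

  accepts-sound : ∀ {m₁} k b (S : GridSubset m₁ m₂) → T (accepts k b S) → MaximalBelow k b S
  accepts-sound k false [] _ = record
    { antichain = λ { (() , _) } ; below = λ { {()} } ; saturated = λ { {()} } ; reaches = λ () }
  accepts-sound k true [] ()
  accepts-sound k b (r ∷ S) t with shape r in e
  ... | empty    = emptyRow-sound (shape-empty r e) (accepts-sound k (afterEmpty k b) S t)
  ... | single y with to (T-∧ {singleOk k b y}) t | shape-single r e
  ...   | ok , rest | jy , refl , only = singleRow-sound only ok (accepts-sound (toℕ jy) false S rest)
  accepts-sound k b (r ∷ S) () | several

  accepts-complete : ∀ {m₁} k b (S : GridSubset m₁ m₂) → k ≤ m₂ → MaximalBelow k b S → T (accepts k b S)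
  accepts-complete k false []      _ _ = tt
  accepts-complete k true  []      _ M with reaches M tt
  ... | () , _
  accepts-complete k b     (r ∷ S) k≤m₂ M with shape r in e
  ... | empty    = accepts-complete k (afterEmpty k b) S k≤m₂ (emptyRow-complete k≤m₂ (shape-empty r e) M)
  ... | single y with shape-single r e
  ...   | jy , refl , only with singleRow-complete only M
  ...     | ok , M′ = from T-∧ (ok , accepts-complete (toℕ jy) false S y≤m₂ M′)
    where y≤m₂ = <⇒≤ (<-≤-trans (below M {fzero} (proj₁ only)) k≤m₂)
  accepts-complete k b     (r ∷ S) _    M | several with shape-several r e
  ... | _ , _ , j<j′ , r[j] , r[j′] = ⊥-elim (severalRow-¬antichain r[j] r[j′] j<j′ (antichain M))

  #accepted : ℕ → ℕ → Bool → ℕ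
  #accepted m₁ k b = countᵇ (accepts {m₁} k b) (allGridSubsets m₁ m₂)

  dF≡#accepted : ∀ m₁ → dF m₁ m₂ ≡ #accepted m₁ m₂ false
  dF≡#accepted m₁ = count≡countᵇ IsMaximalAntichain? (accepts m₂ false) maximal⇔accepts (allGridSubsets m₁ m₂)
    where
    maximal⇔accepts : ∀ S → IsMaximalAntichain S ⇔ T (accepts m₂ false S)
    maximal⇔accepts S = mk⇔ (accepts-complete m₂ false S ≤-refl ∘ maximal⇒MaximalBelow)
                            (MaximalBelow⇒maximal ∘ accepts-sound m₂ false S)

  #accepted-suc : ∀ m₁ k b → #accepted (suc m₁) k b ≡
    #accepted m₁ k (afterEmpty k b) + sumBelow m₂ (λ y → if singleOk k b y then #accepted m₁ y false else 0)
  #accepted-suc m₁ k b =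
    trans (sum-map-allVecs-suc {n = m₁} (λ S → if accepts k b S then 1 else 0) (allVecs bits m₂))
    (trans (sum-shape m₂ (λ c → countᵇ (acceptsRow k b c) subsets) (countᵇ-false subsets))
           (cong (_+_ (#accepted m₁ k (afterEmpty k b)))
                 (sumBelow-cong m₂ λ {y} _ → countᵇ-∧ (singleOk k b y) (accepts y false) subsets)))
    where
    bits = true ∷ false ∷ []
    subsets = allGridSubsets m₁ m₂

  #accepted-suc-false : ∀ m₁ {k} → k ≤ m₂ →
    #accepted (suc m₁) k false ≡ #accepted m₁ k (afterEmpty k false) + sumBelow k (λ y → #accepted m₁ y false)
  #accepted-suc-false m₁ {k} k≤m₂ =
    trans (#accepted-suc m₁ k false) (cong (_+_ (#accepted m₁ k (afterEmpty k false)))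
      (trans (sumBelow-truncate k≤m₂ λ {y} k≤y → if-false λ y<ᵇk → <⇒≱ (<ᵇ⇒< y k y<ᵇk) k≤y)
             (sumBelow-cong k λ y<k → if-true (<⇒<ᵇ y<k))))

  #accepted-suc-true : ∀ m₁ {k} → k < m₂ →
    #accepted (suc m₁) (suc k) true ≡ #accepted m₁ (suc k) true + #accepted m₁ k false
  #accepted-suc-true m₁ {k} k<m₂ =
    trans (#accepted-suc m₁ (suc k) true) (cong (_+_ (#accepted m₁ (suc k) true))
      (trans (sumBelow-single k<m₂ λ {y} y≢k → if-false λ y≡ᵇk →
                y≢k (suc-injective (≡ᵇ⇒≡ (suc y) (suc k) y≡ᵇk)))
             (if-true (≡⇒≡ᵇ (suc k) (suc k) refl))))

  #accepted≡paths : ∀ m₁ → (∀ {k} → k ≤ m₂ → #accepted m₁ k false ≡ paths d m₁ k)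
                         × (∀ {k} → k < m₂ → #accepted m₁ (suc k) true ≡ paths h m₁ (suc k))
  #accepted≡paths zero     = (λ {k} _ → sym (paths-d-zeroˡ k)) , (λ _ → refl)
  #accepted≡paths (suc m₁) = reachFree , reachForced
    where
    IH = #accepted≡paths m₁
    open ≡-Reasoning

    reachFree : ∀ {k} → k ≤ m₂ → #accepted (suc m₁) k false ≡ paths d (suc m₁) k
    reachFree {zero} _ = begin
      #accepted (suc m₁) zero false  ≡⟨ #accepted-suc-false m₁ z≤n ⟩
      #accepted m₁ zero false + 0     ≡⟨ +-identityʳ _ ⟩
      #accepted m₁ zero false         ≡⟨ proj₁ IH z≤n ⟩
      paths d m₁ zero                 ≡⟨ trans (paths-d-zeroʳ m₁) (sym (paths-h-zeroʳ m₁)) ⟩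
      paths h m₁ zero                 ∎
    reachFree {suc k} k<m₂ = begin
      #accepted (suc m₁) (suc k) false
        ≡⟨ #accepted-suc-false m₁ k<m₂ ⟩
      #accepted m₁ (suc k) true + sumBelow (suc k) (λ y → #accepted m₁ y false)
        ≡⟨ cong₂ _+_ (proj₂ IH k<m₂)
                     (sumBelow-cong (suc k) λ y<k+1 → proj₁ IH (≤-trans (≤-pred y<k+1) (<⇒≤ k<m₂))) ⟩
      paths h m₁ (suc k) + sumBelow (suc k) (paths d m₁)
        ≡⟨ cong (_+_ (paths h m₁ (suc k))) (sumBelow-suc k (paths d m₁)) ⟩
      paths h m₁ (suc k) + (sumBelow k (paths d m₁) + paths d m₁ k)
        ≡⟨ cong (λ s → paths h m₁ (suc k) + (s + paths d m₁ k)) (sym (paths-v-sumBelow m₁ k)) ⟩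
      paths h m₁ (suc k) + (paths v (suc m₁) k + paths d m₁ k)
        ≡⟨ sym (+-assoc (paths h m₁ (suc k)) _ _) ⟩
      paths d (suc m₁) (suc k)
        ∎

    reachForced : ∀ {k} → k < m₂ → #accepted (suc m₁) (suc k) true ≡ paths h (suc m₁) (suc k)
    reachForced {k} k<m₂ = begin
      #accepted (suc m₁) (suc k) true                ≡⟨ #accepted-suc-true m₁ k<m₂ ⟩
      #accepted m₁ (suc k) true + #accepted m₁ k false ≡⟨ cong₂ _+_ (proj₂ IH k<m₂) (proj₁ IH (<⇒≤ k<m₂)) ⟩
      paths h m₁ (suc k) + paths d m₁ k              ≡⟨ cong (_+ paths d m₁ k) (sym (+-identityʳ _)) ⟩
      paths h (suc m₁) (suc k)                       ∎

dF≡paths : ∀ m₁ m₂ → dF m₁ m₂ ≡ paths d m₁ m₂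
dF≡paths m₁ m₂ = trans (dF≡#accepted m₁) (proj₁ (#accepted≡paths {m₂} m₁) ≤-refl)

dhF-suc : ∀ m n → dhF (suc m) n ≡ paths h m n
dhF-suc m n = dhF≡startingWith (suc m) n

dhF-suc-mirror : ∀ m n → dhF (suc n) m ≡ paths v m n
dhF-suc-mirror m n = trans (dhF-suc n m) (paths-mirror v m n)

dF-split-v : ∀ m n → dF m (suc n) ≡ dhF (suc m) (suc n) + paths v m n
dF-split-v m n =
  trans (dF≡paths m (suc n))
        (trans (paths-d-split-v m n) (cong (_+ paths v m n) (sym (dhF-suc m (suc n)))))

dF-split-h : ∀ m n → dF m n ≡ dhF m n + paths v m n
dF-split-h m n =
  trans (dF≡paths m n)
        (trans (paths-d-split-h m n) (cong (_+ paths v m n) (sym (dhF≡startingWith m n))))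

+-cancel-ℤ : ∀ (x y z : ℤ) → x ≡ ((x +ℤ y) - (z +ℤ y)) +ℤ z
+-cancel-ℤ = solve-∀

proposition12 : (a b : ℕ) →
    (dF (suc a) (suc b) ≡ dhF (suc a) (suc b) + dhF (suc b) (suc a) + dF a b)
    × (+ dhF (suc a) (suc b) ≡ (+ dF a (suc b) - + dF a b) +ℤ + dhF a b)
proposition12 a b = dF-recurrence , dhF-recurrence
  where
  open ≡-Reasoning

  dF-recurrence : dF (suc a) (suc b) ≡ dhF (suc a) (suc b) + dhF (suc b) (suc a) + dF a b
  dF-recurrence = begin
    dF (suc a) (suc b)
      ≡⟨ dF≡paths (suc a) (suc b) ⟩
    paths h a (suc b) + paths v (suc a) b + paths d a b
      ≡⟨ cong₂ _+_ (cong₂ _+_ (sym (dhF-suc a (suc b))) (sym (dhF-suc-mirror (suc a) b))) (sym (dF≡paths a b)) ⟩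
    dhF (suc a) (suc b) + dhF (suc b) (suc a) + dF a b
      ∎

  dhF-recurrence : + dhF (suc a) (suc b) ≡ (+ dF a (suc b) - + dF a b) +ℤ + dhF a b
  dhF-recurrence = begin
    + X                                   ≡⟨ +-cancel-ℤ (+ X) (+ Y) (+ H) ⟩
    ((+ X +ℤ + Y) - (+ H +ℤ + Y)) +ℤ + H  ≡⟨ cong (_+ℤ + H) (cong₂ _-_ (sym (pos-+ X Y)) (sym (pos-+ H Y))) ⟩
    (+ (X + Y) - + (H + Y)) +ℤ + H        ≡⟨ cong (_+ℤ + H) (cong₂ _-_ (cong +_ (sym (dF-split-v a b)))
                                                                        (cong +_ (sym (dF-split-h a b)))) ⟩
    (+ dF a (suc b) - + dF a b) +ℤ + H    ∎
    where
    X = dhF (suc a) (suc b)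
    Y = paths v a b
    H = dhF a b
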